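{- For every integer $n\geq 2$, $$D_{\mathcal{R}_n^l}(x,q)=2D_{\mathcal{R}_{n-1}}(x,q)-D_{\mathcal{R}_{n-2}}(x,q).$$
   Context: Binary strings and hypercube. For $n\ge 0$ let $\mathcal{B}_n$ be the set of binary strings of length $n$ (the only string of length $0$ is the empty string $\lambda$). The weight $w(u)$ of a binary string $u$ is its number of 1s, and $0^n$ is the all-zero string of length $n$. The hypercube $Q_n$ has vertex set $\mathcal{B}_n$, and two strings are adjacent iff they differ in exactly one position. Run-constrained strings. A run in a binary string is a maximal substring of equal bits. A binary string is run-constrained if every run of 1s is immediately followed by a strictly longer run of 0s. Equivalently, the run-constrained strings are exactly the concatenations of zero or more words from $R=\{0,100,11000,1110000,\dots\}=\{1^i0^{i+1}: i\ge 0\}$. A binary string is circular-run-constrained if every run of 1s is immediately followed, reading the string circularly, by a strictly longer run of 0s. Fibonacci-run and Lucas-run graphs. The Fibonacci-run graph $\mathcal{R}_n$ is the subgraph of $Q_n$ induced by $\{s\in\mathcal{B}_n : s00 \text{ is run-constrained}\}$. The Lucas-run graph $\mathcal{R}_n^l$ is the subgraph of $Q_n$ induced by $\{s\in\mathcal{B}_n : s0 \text{ is circular-run-constrained and } s00 \text{ is run-constrained}\}$. Distance cube polynomial. Let $G$ be an induced subgraph of $Q_n$ containing $0^n$. Every induced subgraph $H$ of $G$ isomorphic to some $Q_k$ has a unique vertex of minimum weight, its bottom vertex. Define $D_G(x,q)=\sum_{k,d\ge 0} c_{k,d}\,x^kq^d$, where $c_{k,d}$ is the number of induced subgraphs of $G$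 that are isomorphic to $Q_k$ and whose bottom vertex has weight $d$. -}

module Defs where

open import Data.Bool using (Bool; true; false; if_then_else_)
open import Data.Bool.Properties using () renaming (_≟_ to _≟B_)
open import Data.Nat using (ℕ; zero; suc; _+_; _<_; _≤_)
open import Data.List using (List; []; _∷_; _++_; length; reverse)
open import Data.List.Relation.Unary.Unique.Propositional using (Unique)
open import Data.List.Membership.Propositional using (_∈_)
open import Data.Vec using (Vec; []; _∷_; toList)
open import Data.Product using (Σ; _×_; _,_; ∃)
open import Data.Unit using (⊤)
open import Data.Empty using (⊥)
open import Relation.Nullary using (does)
open import Relation.Binary.PropositionalEquality using (_≡_)

-- B_n : binary strings of length n (true = 1, false = 0)
Str : ℕ → Set
Str n = Vec Bool n

weight : ∀ {n} → Str n → ℕ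
weight []           = 0
weight (true  ∷ v)  = suc (weight v)
weight (false ∷ v)  = weight v

ham : ∀ {n} → Str n → Str n → ℕ
ham []      []      = 0
ham (a ∷ u) (b ∷ v) = if does (a ≟B b) then ham u v else suc (ham u v)

Adj : ∀ {n} → Str n → Str n → Set
Adj u v = ham u v ≡ 1

-- run-length encoding: list of (bit , length ≥ 1) of the maximal runs
push : Bool → List (Bool × ℕ) → List (Bool × ℕ)
push b []             = (b , 1) ∷ []
push b ((c , k) ∷ rs) =
  if does (b ≟B c) then (c , suc k) ∷ rs else (b , 1) ∷ (c , k) ∷ rs

runs : List Bool → List (Bool × ℕ)
runs []      = []
runs (b ∷ w) = push b (runs w)

LinOK : List (Bool × ℕ) → Set
LinOK []                               = ⊤
LinOK ((false , _) ∷ rs)               = LinOK rs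
LinOK ((true , a) ∷ [])                = ⊥
LinOK ((true , a) ∷ (c , b) ∷ rs)      = (c ≡ false) × (a < b) × LinOK ((c , b) ∷ rs)

RunConstrained : List Bool → Set
RunConstrained w = LinOK (runs w)

-- circular reading: if there are ≥ 2 runs and first and last run have
-- the same bit, they merge into one circular run
mergeEnds : Bool × ℕ → List (Bool × ℕ) → List (Bool × ℕ) → List (Bool × ℕ)
mergeEnds (b , a) orig []                    = orig
mergeEnds (b , a) orig ((c , z) ∷ revMid)    =
  if does (b ≟B c) then (b , a + z) ∷ reverse revMid else orig

circRuns : List (Bool × ℕ) → List (Bool × ℕ)
circRuns []            = []
circRuns (x ∷ [])      = x ∷ []
circRuns (x ∷ y ∷ ys)  = mergeEnds x (x ∷ y ∷ ys) (reverse (y ∷ ys))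

step : Bool × ℕ → Bool × ℕ → Set
step (false , _) _       = ⊤
step (true , a) (c , b)  = (c ≡ false) × (a < b)

cyc : Bool × ℕ → List (Bool × ℕ) → Set
cyc first []            = ⊤
cyc first (x ∷ [])      = step x first
cyc first (x ∷ y ∷ rs)  = step x y × cyc first (y ∷ rs)

CircOK : List (Bool × ℕ) → Set
CircOK []         = ⊤
CircOK (r ∷ rs)   = cyc r (r ∷ rs)

CircRunConstrained : List Bool → Set
CircRunConstrained w = CircOK (circRuns (runs w))

FibRunV : (n : ℕ) → Str n → Set
FibRunV n s = RunConstrained (toList s ++ false ∷ false ∷ [])

LucRunV : (n : ℕ) → Str n → Set
LucRunV n s = CircRunConstrained (toList s ++ false ∷ [])
            × RunConstrained (toList s ++ false ∷ false ∷ [])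

data Subset : ℕ → Set where
  leaf : Bool → Subset zero
  node : ∀ {n} → Subset n → Subset n → Subset (suc n)

-- membership: node l r stores strings starting with 0 in l, with 1 in r
_∈S_ : ∀ {n} → Str n → Subset n → Set
[]          ∈S leaf b      = b ≡ true
(false ∷ v) ∈S node l r    = v ∈S l
(true  ∷ v) ∈S node l r    = v ∈S r

InducedQk : ∀ {n} → (Str n → Set) → ℕ → Subset n → Set
InducedQk {n} V k S =
  (∀ v → v ∈S S → V v) ×
  Σ (Str k → Str n) λ f →
    (∀ u u′ → f u ≡ f u′ → u ≡ u′) ×
    (∀ u → f u ∈S S) ×
    (∀ v → v ∈S S → ∃ λ u → f u ≡ v) ×
    (∀ u u′ → Adj u u′ → Adj (f u) (f u′)) ×
    (∀ u u′ → Adj (f u) (f u′) → Adj u u′)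

BottomWeight : ∀ {n} → Subset n → ℕ → Set
BottomWeight S d =
  (∃ λ v → v ∈S S × weight v ≡ d) × (∀ v → v ∈S S → d ≤ weight v)

-- "exactly m subsets S of B_n satisfy P": witnessed by a duplicate-free
-- list of length m whose members are exactly the S with P S
HasCount : ∀ {n} → (Subset n → Set) → ℕ → Set
HasCount {n} P m =
  Σ (List (Subset n)) λ L →
    length L ≡ m × Unique L × (∀ S → (S ∈ L → P S) × (P S → S ∈ L))

-- c_{k,d}(G) = m : the coefficient of x^k q^d in D_G(x,q) is m
CubeCoeff : (n : ℕ) → (Str n → Set) → ℕ → ℕ → ℕ → Set
CubeCoeff n V k d m = HasCount (λ S → InducedQk V k S × BottomWeight S d) m

{-# OPTIONS --safe #-}
-- Call a cube 1-headed if one of its vertices starts with 1, and let B count the 1-headed k-cubes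
-- of R_{m+1} with bottom weight d. Prepending and appending a 0 preserve adjacency and weight, so
-- they carry cubes to cubes with the same bottom weight. A cube of R_{m+1} that is not 1-headed is
-- 0Q for a cube Q of R_m, hence b = c + B. A cube of R^l_{m+2} that is not 1-headed is 0Q for a
-- cube Q of R_{m+1}. If it is 1-headed and also has a vertex starting with 0, the first coordinate
-- is one of its directions, so every vertex lifts to a Lucas-run string starting with 1; such a
-- string ends with 0. Hence the 1-headed cubes of R^l_{m+2} are the Q0 for 1-headed cubes Q of
-- R_{m+1}, and a = b + B. Thus a + c = 2b.
module Submission where

open import Defs
open import Data.Bool using (Bool; true; false; not)
open import Data.Bool.Properties using (not-involutive; not-¬) renaming (_≟_ to _≟B_)
open import Data.Empty using (⊥-elim)
open import Data.Fin using (Fin; zero; suc)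
open import Data.Fin.Properties using () renaming (_≟_ to _≟F_)
open import Data.List using (List; []; _∷_; _++_; [_]; reverse; replicate; length; map; filter)
open import Data.List.Properties using (reverse-involutive; reverse-++; length-++; length-map)
open import Data.List.Membership.Propositional using (_∈_)
open import Data.List.Membership.Propositional.Properties
  using (∈-map⁺; ∈-map⁻; ∈-filter⁺; ∈-filter⁻; ∈-++⁺ˡ; ∈-++⁺ʳ; ∈-++⁻)
open import Data.List.Membership.Propositional.Properties.WithK using (unique∧set⇒bag)
open import Data.List.Relation.Binary.BagAndSetEquality using (∼bag⇒↭)
open import Data.List.Relation.Binary.Disjoint.Propositional using (Disjoint)
open import Data.List.Relation.Binary.Permutation.Propositional.Properties using (↭-length)
open import Data.List.Relation.Unary.Unique.Propositional using (Unique)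
open import Data.List.Relation.Unary.Unique.Propositional.Properties using (++⁺; map⁺; filter⁺)
open import Data.Nat using (ℕ; zero; suc; _+_; _*_; _≤_; s≤s; z≤n)
open import Data.Nat.Properties
  using ( +-assoc; +-comm; +-identityʳ; +-suc; suc-injective; n<1+n; <-trans; <-≤-trans
        ; +-monoˡ-≤; m≤n+m)
open import Data.Product using (_×_; _,_; proj₁; proj₂; ∃; ∃₂)
open import Data.Sum using (_⊎_; inj₁; inj₂; [_,_]′)
open import Data.Unit using (tt)
open import Data.Vec using ([]; _∷_; head; tail; _∷ʳ_; init; initLast; toList)
open import Data.Vec.Properties using (init-∷ʳ)
open import Function.Base using (_∘_; id)
open import Function.Bundles using (_⇔_; mk⇔; module Equivalence)
open import Function.Construct.Composition using (_⇔-∘_)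
open import Function.Construct.Symmetry using (⇔-sym)
open import Relation.Nullary using (¬_; Dec; yes; no; does)
open import Relation.Binary.PropositionalEquality
  using (_≡_; _≢_; refl; sym; trans; cong; cong₂; subst; subst₂; module ≡-Reasoning)

open Equivalence using (to; from)
-- Hypercube

flip : ∀ {n} → Fin n → Str n → Str n
flip zero    (b ∷ x) = not b ∷ x
flip (suc i) (b ∷ x) = b ∷ flip i x

ham-refl : ∀ {n} (x : Str n) → ham x x ≡ 0
ham-refl []          = refl
ham-refl (false ∷ x) = ham-refl x
ham-refl (true  ∷ x) = ham-refl x

ham≡0⇒≡ : ∀ {n} (x y : Str n) → ham x y ≡ 0 → x ≡ y
ham≡0⇒≡ []          []          _  = refl
ham≡0⇒≡ (false ∷ x) (false ∷ y) h  = cong (false ∷_) (ham≡0⇒≡ x y h)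
ham≡0⇒≡ (true  ∷ x) (true  ∷ y) h  = cong (true ∷_) (ham≡0⇒≡ x y h)
ham≡0⇒≡ (false ∷ x) (true  ∷ y) ()
ham≡0⇒≡ (true  ∷ x) (false ∷ y) ()

Adj-not-head⇒≡ : ∀ {n} b (x y : Str n) → Adj (b ∷ x) (not b ∷ y) → x ≡ y
Adj-not-head⇒≡ false x y h = ham≡0⇒≡ x y (suc-injective h)
Adj-not-head⇒≡ true  x y h = ham≡0⇒≡ x y (suc-injective h)

Adj-flip : ∀ {n} (i : Fin n) (x : Str n) → Adj x (flip i x)
Adj-flip zero    (false ∷ x) = cong suc (ham-refl x)
Adj-flip zero    (true  ∷ x) = cong suc (ham-refl x)
Adj-flip (suc i) (false ∷ x) = Adj-flip i x
Adj-flip (suc i) (true  ∷ x) = Adj-flip i x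

Adj⇒flip : ∀ {n} (x y : Str n) → Adj x y → ∃ λ i → y ≡ flip i x
Adj⇒flip []          []          ()
Adj⇒flip (false ∷ x) (false ∷ y) h with i , e ← Adj⇒flip x y h = suc i , cong (false ∷_) e
Adj⇒flip (true  ∷ x) (true  ∷ y) h with i , e ← Adj⇒flip x y h = suc i , cong (true ∷_) e
Adj⇒flip (false ∷ x) (true  ∷ y) h = zero , cong (true ∷_) (sym (Adj-not-head⇒≡ false x y h))
Adj⇒flip (true  ∷ x) (false ∷ y) h = zero , cong (false ∷_) (sym (Adj-not-head⇒≡ true x y h))

Adj⇒flip₀ : ∀ {n} (x y : Str (suc n)) → Adj x y → head x ≢ head y → y ≡ flip zero x
Adj⇒flip₀ (false ∷ x) (false ∷ y) _ h≢ = ⊥-elim (h≢ refl)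
Adj⇒flip₀ (true  ∷ x) (true  ∷ y) _ h≢ = ⊥-elim (h≢ refl)
Adj⇒flip₀ (false ∷ x) (true  ∷ y) h _  = cong (true ∷_) (sym (Adj-not-head⇒≡ false x y h))
Adj⇒flip₀ (true  ∷ x) (false ∷ y) h _  = cong (false ∷_) (sym (Adj-not-head⇒≡ true x y h))

flip-involutive : ∀ {n} (i : Fin n) (x : Str n) → flip i (flip i x) ≡ x
flip-involutive zero    (b ∷ x) = cong (_∷ x) (not-involutive b)
flip-involutive (suc i) (b ∷ x) = cong (b ∷_) (flip-involutive i x)

flip-comm : ∀ {n} (i j : Fin n) (x : Str n) → flip i (flip j x) ≡ flip j (flip i x)
flip-comm zero    zero    (b ∷ x) = refl
flip-comm zero    (suc j) (b ∷ x) = refl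
flip-comm (suc i) zero    (b ∷ x) = refl
flip-comm (suc i) (suc j) (b ∷ x) = cong (b ∷_) (flip-comm i j x)

flip-injectiveˡ : ∀ {n} (i j : Fin n) (x : Str n) → flip i x ≡ flip j x → i ≡ j
flip-injectiveˡ zero    zero    (b ∷ x) _ = refl
flip-injectiveˡ zero    (suc j) (b ∷ x) e = ⊥-elim (not-¬ refl (sym (cong head e)))
flip-injectiveˡ (suc i) zero    (b ∷ x) e = ⊥-elim (not-¬ refl (cong head e))
flip-injectiveˡ (suc i) (suc j) (b ∷ x) e = cong suc (flip-injectiveˡ i j x (cong tail e))

common-neighbours : ∀ {n} (p : Fin n) (x z : Str (suc n)) →
  Adj (flip (suc p) x) z → Adj (flip zero x) z → z ≡ x ⊎ z ≡ flip zero (flip (suc p) x)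
common-neighbours p (false ∷ x) (false ∷ z) _ h =
  inj₁ (cong (false ∷_) (sym (Adj-not-head⇒≡ true x z h)))
common-neighbours p (true  ∷ x) (true  ∷ z) _ h =
  inj₁ (cong (true ∷_) (sym (Adj-not-head⇒≡ false x z h)))
common-neighbours p (false ∷ x) (true  ∷ z) h _ =
  inj₂ (cong (true ∷_) (sym (Adj-not-head⇒≡ false (flip p x) z h)))
common-neighbours p (true  ∷ x) (false ∷ z) h _ =
  inj₂ (cong (false ∷_) (sym (Adj-not-head⇒≡ true (flip p x) z h)))

flip-closed⇒universal : ∀ {k} (P : Str k → Set) → (∀ u j → P u → P (flip j u)) →
  ∀ w → P w → ∀ u → P u
flip-closed⇒universal P _ [] Pw [] = Pw
flip-closed⇒universal P closed (b ∷ w) Pw (c ∷ u) =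
  flip-closed⇒universal P′ (λ v j P′v c → closed (c ∷ v) (suc j) (P′v c)) w
    (λ c → any-head b c Pw) u c
  where
  P′ : Str _ → Set
  P′ v = ∀ c → P (c ∷ v)
  any-head : ∀ b c → P (b ∷ w) → P (c ∷ w)
  any-head false false p = p
  any-head true  true  p = p
  any-head false true  p = closed _ zero p
  any-head true  false p = closed _ zero p

changing-edge : ∀ {k} (φ : Str k → Bool) u₀ u₁ → φ u₀ ≢ φ u₁ →
  ∃₂ λ w i → φ w ≢ φ (flip i w)
changing-edge φ u₀ u₁ φ≢ =
  [ ⊥-elim ∘ φ≢ , id ]′ (flip-closed⇒universal P closed u₁ (inj₁ refl) u₀)
  where
  P : Str _ → Set
  P u = φ u ≡ φ u₁ ⊎ ∃₂ λ w i → φ w ≢ φ (flip i w)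
  closed : ∀ u j → P u → P (flip j u)
  closed u j (inj₂ edge) = inj₂ edge
  closed u j (inj₁ φu≡) with φ (flip j u) ≟B φ u₁
  ... | yes φu′≡ = inj₁ φu′≡
  ... | no  φu′≢ = inj₂ (u , j , λ e → φu′≢ (trans (sym e) φu≡))

module _ {k n} {f : Str k → Str (suc n)}
         (f-injective : ∀ u u′ → f u ≡ f u′ → u ≡ u′)
         (f-adjacent : ∀ u u′ → Adj u u′ → Adj (f u) (f u′)) where

  Flips₀Along : Fin k → Str k → Set
  Flips₀Along i u = f (flip i u) ≡ flip zero (f u)

  -- For j ≢ i, f (flip j w) is f w flipped at some coordinate p ≢ 0, and f (flip i (flip j w))
  -- is a common neighbour of it and of flip zero (f w) other than f w: the fourth corner.
  flips₀Along-closed : ∀ i u j → Flips₀Along i u → Flips₀Along i (flip j u)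
  flips₀Along-closed i w j hw with j ≟F i
  ... | yes refl = begin
    f (flip j (flip j w))        ≡⟨ cong f (flip-involutive j w) ⟩
    f w                          ≡⟨ sym (flip-involutive zero (f w)) ⟩
    flip zero (flip zero (f w))  ≡⟨ cong (flip zero) (sym hw) ⟩
    flip zero (f (flip j w))     ∎
    where open ≡-Reasoning
  ... | no j≢i = along (Adj⇒flip (f w) (f (flip j w)) (f-adjacent _ _ (Adj-flip j w)))
    where
    z = f (flip i (flip j w))
    fjw∼z : Adj (f (flip j w)) z
    fjw∼z = f-adjacent _ _ (Adj-flip i (flip j w))
    fiw∼z : Adj (f (flip i w)) z
    fiw∼z = f-adjacent _ _ (subst (Adj (flip i w)) (flip-comm j i w) (Adj-flip j (flip i w)))
    along : (∃ λ q → f (flip j w) ≡ flip q (f w)) → Flips₀Along i (flip j w)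
    along (zero , e) =
      ⊥-elim (j≢i (flip-injectiveˡ j i w (f-injective _ _ (trans e (sym hw)))))
    along (suc p , e)
      with common-neighbours p (f w) z (subst (λ x → Adj x z) e fjw∼z)
                                       (subst (λ x → Adj x z) hw fiw∼z)
    ... | inj₂ z≡ = trans z≡ (cong (flip zero) (sym e))
    ... | inj₁ z≡fw = ⊥-elim (j≢i (flip-injectiveˡ j i w (begin
      flip j w                   ≡⟨ sym (flip-involutive i (flip j w)) ⟩
      flip i (flip i (flip j w)) ≡⟨ cong (flip i) (f-injective _ _ z≡fw) ⟩
      flip i w                   ∎)))
      where open ≡-Reasoning

  head-nonconstant⇒direction : ∀ u₀ u₁ → head (f u₀) ≢ head (f u₁) →
    ∃ λ i → ∀ u → Flips₀Along i u
  head-nonconstant⇒direction u₀ u₁ head≢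
    with w , i , edge ← changing-edge (head ∘ f) u₀ u₁ head≢ =
    i , flip-closed⇒universal (Flips₀Along i) (flips₀Along-closed i) w
          (Adj⇒flip₀ (f w) (f (flip i w)) (f-adjacent _ _ (Adj-flip i w)) edge)

InducedQk-head-closed : ∀ {n k} {V : Str (suc n) → Set} {S x y} → InducedQk V k S →
  (true ∷ x) ∈S S → (false ∷ y) ∈S S → (true ∷ y) ∈S S
InducedQk-head-closed {S = S} {x} {y} (_ , f , f-inj , f∈S , onto , f-adj , _) x∈ y∈
  with u₀ , e₀ ← onto (true ∷ x) x∈ | u₁ , e₁ ← onto (false ∷ y) y∈
  with i , along ← head-nonconstant⇒direction f-inj f-adj u₀ u₁
                     (subst₂ _≢_ (sym (cong head e₀)) (sym (cong head e₁)) λ ())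
  = subst (_∈S S) (trans (along u₁) (cong (flip zero) e₁)) (f∈S (flip i u₁))

-- Run-length encodings

push0⁺ : ∀ rs → LinOK rs → LinOK (push false rs)
push0⁺ []                _ = tt
push0⁺ ((false , _) ∷ _) h = h
push0⁺ ((true  , _) ∷ _) h = h

push⁻ : ∀ b rs → LinOK (push b rs) → LinOK rs
push⁻ _     []                          _               = tt
push⁻ false ((false , _) ∷ _)           h               = h
push⁻ false ((true  , _) ∷ _)           h               = h
push⁻ true  ((false , _) ∷ _)           (_ , _ , h)     = h
push⁻ true  ((true  , _) ∷ [])          ()
push⁻ true  ((true  , k) ∷ (_ , _) ∷ _) (c≡0 , k<j , h) = c≡0 , <-trans (n<1+n k) k<j , h

RunConstrained-++⁻ʳ : ∀ u v → RunConstrained (u ++ v) → RunConstrained v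
RunConstrained-++⁻ʳ []      v h = h
RunConstrained-++⁻ʳ (b ∷ u) v h = RunConstrained-++⁻ʳ u v (push⁻ b (runs (u ++ v)) h)

¬RunConstrained-ending-10 : ∀ u → ¬ RunConstrained (u ++ true ∷ false ∷ [])
¬RunConstrained-ending-10 u h = ¬RunConstrained-10 (RunConstrained-++⁻ʳ u _ h)
  where
  ¬RunConstrained-10 : ¬ RunConstrained (true ∷ false ∷ [])
  ¬RunConstrained-10 (_ , s≤s () , _)

-- The final run has length suc (e + t), so that at e = 0 and e = 1 it is suc t and suc (suc t).
push-last0 : ∀ b pre t → ∃₂ λ pre′ t′ → ∀ e →
  push b (pre ++ [ (false , suc (e + t)) ]) ≡ pre′ ++ [ (false , suc (e + t′)) ]
push-last0 false [] t = [] , suc t , λ e → cong (λ x → [ (false , suc x) ]) (sym (+-suc e t))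
push-last0 true  [] t = [ (true , 1) ] , t , λ _ → refl
push-last0 b ((c , k) ∷ pre) t with does (b ≟B c)
... | true  = (c , suc k) ∷ pre , t , λ _ → refl
... | false = (b , 1) ∷ (c , k) ∷ pre , t , λ _ → refl

runs-++-0s : ∀ u → ∃₂ λ pre t → ∀ e →
  runs (u ++ false ∷ replicate e false) ≡ pre ++ [ (false , suc (e + t)) ]
runs-++-0s [] = [] , 0 , runs-0s
  where
  runs-0s : ∀ e → runs (false ∷ replicate e false) ≡ [ (false , suc (e + 0)) ]
  runs-0s zero    = refl
  runs-0s (suc e) = cong (push false) (runs-0s e)
runs-++-0s (b ∷ u)
  with pre , t , eq ← runs-++-0s u
  with pre′ , t′ , eq′ ← push-last0 b pre t =
  pre′ , t′ , λ e → trans (cong (push b) (eq e)) (eq′ e)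

LinOK-last0-mono : ∀ pre {a b} → a ≤ b →
  LinOK (pre ++ [ (false , a) ]) → LinOK (pre ++ [ (false , b) ])
LinOK-last0-mono []                            _   _               = tt
LinOK-last0-mono ((false , _) ∷ pre)           a≤b h               = LinOK-last0-mono pre a≤b h
LinOK-last0-mono ((true  , _) ∷ [])            a≤b (c≡0 , k<a , _) =
  c≡0 , <-≤-trans k<a a≤b , tt
LinOK-last0-mono ((true  , _) ∷ (c , j) ∷ pre) a≤b (c≡0 , k<j , h) =
  c≡0 , k<j , LinOK-last0-mono ((c , j) ∷ pre) a≤b h

RunConstrained-0s-mono : ∀ u {e e′} → e ≤ e′ →
  RunConstrained (u ++ false ∷ replicate e false) →
  RunConstrained (u ++ false ∷ replicate e′ false)
RunConstrained-0s-mono u {e} {e′} e≤e′ h with pre , t , eq ← runs-++-0s u =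
  subst LinOK (sym (eq e′))
    (LinOK-last0-mono pre (s≤s (+-monoˡ-≤ t e≤e′)) (subst LinOK (eq e) h))

LinOK-∷∷ : ∀ y z zs → LinOK (y ∷ z ∷ zs) ⇔ (step y z × LinOK (z ∷ zs))
LinOK-∷∷ (false , _) _ _ = mk⇔ (tt ,_) proj₂
LinOK-∷∷ (true  , _) _ _ =
  mk⇔ (λ (c≡0 , a<b , h) → (c≡0 , a<b) , h) (λ ((c≡0 , a<b) , h) → c≡0 , a<b , h)

cyc⇔LinOK : ∀ f y L b →
  cyc f (y ∷ L ++ [ (false , b) ]) ⇔ LinOK (y ∷ L ++ [ (false , b) ])
cyc⇔LinOK f y []      b = ⇔-sym (LinOK-∷∷ y (false , b) [])
cyc⇔LinOK f y (z ∷ L) b = mk⇔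
  (λ (y→z , c) → from (LinOK-∷∷ y z _) (y→z , to (cyc⇔LinOK f z L b) c))
  (λ h → let y→z , h′ = to (LinOK-∷∷ y z _) h in y→z , from (cyc⇔LinOK f z L b) h′)

CircOK-0∷ : ∀ c p → LinOK (p ++ [ (false , c) ]) → CircOK ((false , c) ∷ p)
CircOK-0∷ c []      _ = tt
CircOK-0∷ c (y ∷ L) h = tt , closing y L h
  where
  closing : ∀ y L → LinOK (y ∷ L ++ [ (false , c) ]) → cyc (false , c) (y ∷ L)
  closing y []      h = proj₁ (to (LinOK-∷∷ y (false , c) []) h)
  closing y (z ∷ L) h = let y→z , h′ = to (LinOK-∷∷ y z _) h in y→z , closing z L h′

circRuns-∷-∷ʳ : ∀ x pre l →
  circRuns (x ∷ pre ++ [ l ]) ≡ mergeEnds x (x ∷ pre ++ [ l ]) (l ∷ reverse pre)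
circRuns-∷-∷ʳ x []        l = refl
circRuns-∷-∷ʳ x (y ∷ pre) l =
  cong (mergeEnds x (x ∷ y ∷ pre ++ [ l ])) (reverse-++ (y ∷ pre) [ l ])

circRuns-1⋯0 : ∀ a pre T →
  circRuns ((true , a) ∷ pre ++ [ (false , T) ]) ≡ (true , a) ∷ pre ++ [ (false , T) ]
circRuns-1⋯0 a pre T = circRuns-∷-∷ʳ (true , a) pre (false , T)

circRuns-0⋯0 : ∀ a pre T →
  circRuns ((false , a) ∷ pre ++ [ (false , T) ]) ≡ (false , a + T) ∷ pre
circRuns-0⋯0 a pre T =
  trans (circRuns-∷-∷ʳ (false , a) pre (false , T))
        (cong ((false , a + T) ∷_) (reverse-involutive pre))

push1-last0 : ∀ pre T → ∃₂ λ a pre′ →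
  push true (pre ++ [ (false , T) ]) ≡ (true , a) ∷ pre′ ++ [ (false , T) ]
push1-last0 []                  T = 1 , [] , refl
push1-last0 ((false , k) ∷ pre) T = 1 , (false , k) ∷ pre , refl
push1-last0 ((true  , k) ∷ pre) T = suc k , pre , refl

CircRunConstrained-1⋯0⇔ : ∀ u →
  CircRunConstrained (true ∷ u ++ [ false ]) ⇔ RunConstrained (true ∷ u ++ [ false ])
CircRunConstrained-1⋯0⇔ u
  with pre , t , eq ← runs-++-0s u
  with a , pre′ , eq′ ← push1-last0 pre (suc t)
  rewrite eq 0 | eq′ | circRuns-1⋯0 a pre′ (suc t) =
  cyc⇔LinOK (true , a) (true , a) pre′ (suc t)

RunConstrained⇒CircRunConstrained-0⋯0 : ∀ u →
  RunConstrained (u ++ false ∷ false ∷ []) → CircRunConstrained (false ∷ u ++ [ false ])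
RunConstrained⇒CircRunConstrained-0⋯0 u h with pre , t , eq ← runs-++-0s u
  rewrite eq 0 = circ-push0 pre (suc t) (subst LinOK (eq 1) h)
  where
  circ-push0 : ∀ pre T → LinOK (pre ++ [ (false , suc T) ]) →
    CircOK (circRuns (push false (pre ++ [ (false , T) ])))
  circ-push0 []                T _ = tt
  circ-push0 ((true , a) ∷ p)  T h =
    subst CircOK (sym (circRuns-0⋯0 1 ((true , a) ∷ p) T)) (CircOK-0∷ _ ((true , a) ∷ p) h)
  circ-push0 ((false , a) ∷ p) T h =
    subst CircOK (sym (circRuns-0⋯0 (suc a) p T))
      (CircOK-0∷ _ p (LinOK-last0-mono p (s≤s (m≤n+m T a)) h))

-- Fibonacci-run and Lucas-run strings

toList-∷ʳ-++ : ∀ {n} (s : Str n) b w → toList (s ∷ʳ b) ++ w ≡ toList s ++ b ∷ w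
toList-∷ʳ-++ []      b w = refl
toList-∷ʳ-++ (x ∷ s) b w = cong (x ∷_) (toList-∷ʳ-++ s b w)

FibRunV-0∷ : ∀ {n} (s : Str n) → FibRunV (suc n) (false ∷ s) ⇔ FibRunV n s
FibRunV-0∷ s = mk⇔ (push⁻ false rs) (push0⁺ rs)
  where rs = runs (toList s ++ false ∷ false ∷ [])

FibRunV-1∷⁻ : ∀ {n} (s : Str n) → FibRunV (suc n) (true ∷ s) → FibRunV n s
FibRunV-1∷⁻ s = push⁻ true (runs (toList s ++ false ∷ false ∷ []))

FibRunV-∷ʳ0 : ∀ {n} (s : Str n) → FibRunV n s → FibRunV (suc n) (s ∷ʳ false)
FibRunV-∷ʳ0 s h = subst RunConstrained (sym (toList-∷ʳ-++ s false _))
  (RunConstrained-0s-mono (toList s) (s≤s z≤n) h)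

LucRunV-0∷ : ∀ {n} (s : Str n) → LucRunV (suc n) (false ∷ s) ⇔ FibRunV n s
LucRunV-0∷ s = mk⇔ (to (FibRunV-0∷ s) ∘ proj₂)
  (λ h → RunConstrained⇒CircRunConstrained-0⋯0 (toList s) h , from (FibRunV-0∷ s) h)

LucRunV-∷ʳ0 : ∀ {n} (s : Str n) → FibRunV n s → LucRunV (suc n) (s ∷ʳ false)
LucRunV-∷ʳ0 []          h = from (LucRunV-0∷ []) h
LucRunV-∷ʳ0 (false ∷ s) h =
  from (LucRunV-0∷ (s ∷ʳ false)) (FibRunV-∷ʳ0 s (to (FibRunV-0∷ s) h))
LucRunV-∷ʳ0 (true  ∷ s) h =
  from (CircRunConstrained-1⋯0⇔ (toList (s ∷ʳ false)))
    (subst (RunConstrained ∘ (true ∷_)) (sym (toList-∷ʳ-++ s false _)) h) ,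
  FibRunV-∷ʳ0 (true ∷ s) h

LucRunV-1∷-∷ʳ0⁻ : ∀ {n} (t : Str n) →
  LucRunV (suc (suc n)) (true ∷ (t ∷ʳ false)) → FibRunV (suc n) (true ∷ t)
LucRunV-1∷-∷ʳ0⁻ t (circ , _) =
  subst (RunConstrained ∘ (true ∷_)) (toList-∷ʳ-++ t false _)
    (to (CircRunConstrained-1⋯0⇔ (toList (t ∷ʳ false))) circ)

¬LucRunV-1∷-∷ʳ1 : ∀ {n} (t : Str n) → ¬ LucRunV (suc (suc n)) (true ∷ (t ∷ʳ true))
¬LucRunV-1∷-∷ʳ1 t (circ , _) = ¬RunConstrained-ending-10 (true ∷ toList t)
  (subst (RunConstrained ∘ (true ∷_)) (toList-∷ʳ-++ t true _)
    (to (CircRunConstrained-1⋯0⇔ (toList (t ∷ʳ true))) circ))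

-- Subsets of B_n

∅ : ∀ n → Subset n
∅ zero    = leaf false
∅ (suc n) = node (∅ n) (∅ n)

∉∅ : ∀ {n} (v : Str n) → ¬ v ∈S ∅ n
∉∅ []          ()
∉∅ (false ∷ v) = ∉∅ v
∉∅ (true  ∷ v) = ∉∅ v

∈S-ext : ∀ {n} (A B : Subset n) →
  (∀ v → v ∈S A → v ∈S B) → (∀ v → v ∈S B → v ∈S A) → A ≡ B
∈S-ext (leaf false) (leaf false) _   _   = refl
∈S-ext (leaf true)  (leaf true)  _   _   = refl
∈S-ext (leaf false) (leaf true)  _   B⊆A with () ← B⊆A [] refl
∈S-ext (leaf true)  (leaf false) A⊆B _   with () ← A⊆B [] refl
∈S-ext (node l r) (node l′ r′) A⊆B B⊆A =
  cong₂ node (∈S-ext l l′ (λ v → A⊆B (false ∷ v)) (λ v → B⊆A (false ∷ v)))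
             (∈S-ext r r′ (λ v → A⊆B (true ∷ v)) (λ v → B⊆A (true ∷ v)))

inhabited? : ∀ {n} (S : Subset n) → Dec (∃ (_∈S S))
inhabited? (leaf true)  = yes ([] , refl)
inhabited? (leaf false) = no λ { ([] , ()) }
inhabited? (node l r) with inhabited? l | inhabited? r
... | yes (v , v∈) | _            = yes (false ∷ v , v∈)
... | no _         | yes (v , v∈) = yes (true ∷ v , v∈)
... | no l-empty   | no r-empty   = no λ { (false ∷ v , v∈) → l-empty (v , v∈)
                                         ; (true  ∷ v , v∈) → r-empty (v , v∈) }

uninhabited⇒≡∅ : ∀ {n} (S : Subset n) → ¬ ∃ (_∈S S) → S ≡ ∅ n
uninhabited⇒≡∅ S empty =
  ∈S-ext S (∅ _) (λ v v∈ → ⊥-elim (empty (v , v∈))) (λ v v∈ → ⊥-elim (∉∅ v v∈))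

ones : ∀ {n} → Subset (suc n) → Subset n
ones (node _ r) = r

Has1Head : ∀ {n} → Subset (suc n) → Set
Has1Head S = ∃ (_∈S ones S)

has1Head? : ∀ {n} (S : Subset (suc n)) → Dec (Has1Head S)
has1Head? S = inhabited? (ones S)

prepend0 : ∀ {n} → Subset n → Subset (suc n)
prepend0 S = node S (∅ _)

prepend0-injective : ∀ {n} {S T : Subset n} → prepend0 S ≡ prepend0 T → S ≡ T
prepend0-injective refl = refl

∈-prepend0⁻ : ∀ {n} (S : Subset n) v → v ∈S prepend0 S →
  ∃ λ s → v ≡ false ∷ s × s ∈S S
∈-prepend0⁻ S (false ∷ s) s∈ = s , refl , s∈
∈-prepend0⁻ S (true  ∷ s) s∈ = ⊥-elim (∉∅ s s∈)

¬Has1Head-prepend0 : ∀ {n} (S : Subset n) → ¬ Has1Head (prepend0 S)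
¬Has1Head-prepend0 S (v , v∈) = ∉∅ v v∈

append0 : ∀ {n} → Subset n → Subset (suc n)
append0 (leaf b)   = node (leaf b) (leaf false)
append0 (node l r) = node (append0 l) (append0 r)

unappend0 : ∀ {n} → Subset (suc n) → Subset n
unappend0 {zero}  (node l _) = l
unappend0 {suc n} (node l r) = node (unappend0 l) (unappend0 r)

∈-append0⁺ : ∀ {n} (S : Subset n) s → s ∈S S → (s ∷ʳ false) ∈S append0 S
∈-append0⁺ (leaf _)   []          s∈ = s∈
∈-append0⁺ (node l _) (false ∷ s) s∈ = ∈-append0⁺ l s s∈
∈-append0⁺ (node _ r) (true  ∷ s) s∈ = ∈-append0⁺ r s s∈

∈-append0⁻ : ∀ {n} (S : Subset n) v → v ∈S append0 S →
  ∃ λ s → v ≡ s ∷ʳ false × s ∈S S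
∈-append0⁻ (leaf _)   (false ∷ []) v∈ = [] , refl , v∈
∈-append0⁻ (leaf _)   (true  ∷ []) ()
∈-append0⁻ (node l _) (false ∷ v)  v∈ with s , refl , s∈ ← ∈-append0⁻ l v v∈ =
  false ∷ s , refl , s∈
∈-append0⁻ (node _ r) (true  ∷ v)  v∈ with s , refl , s∈ ← ∈-append0⁻ r v v∈ =
  true ∷ s , refl , s∈

∈-unappend0⁺ : ∀ {n} (S : Subset (suc n)) s → (s ∷ʳ false) ∈S S → s ∈S unappend0 S
∈-unappend0⁺ {zero}  (node _ _) []          s∈ = s∈
∈-unappend0⁺ {suc n} (node l _) (false ∷ s) s∈ = ∈-unappend0⁺ l s s∈
∈-unappend0⁺ {suc n} (node _ r) (true  ∷ s) s∈ = ∈-unappend0⁺ r s s∈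

∈-unappend0⁻ : ∀ {n} (S : Subset (suc n)) s → s ∈S unappend0 S → (s ∷ʳ false) ∈S S
∈-unappend0⁻ {zero}  (node _ _) []          s∈ = s∈
∈-unappend0⁻ {suc n} (node l _) (false ∷ s) s∈ = ∈-unappend0⁻ l s s∈
∈-unappend0⁻ {suc n} (node _ r) (true  ∷ s) s∈ = ∈-unappend0⁻ r s s∈

unappend0-append0 : ∀ {n} (S : Subset n) → unappend0 (append0 S) ≡ S
unappend0-append0 (leaf _)   = refl
unappend0-append0 (node l r) = cong₂ node (unappend0-append0 l) (unappend0-append0 r)

append0-injective : ∀ {n} {S T : Subset n} → append0 S ≡ append0 T → S ≡ T
append0-injective {S = S} {T} e =
  trans (sym (unappend0-append0 S)) (trans (cong unappend0 e) (unappend0-append0 T))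

append0-unappend0 : ∀ {n} (S : Subset (suc n)) →
  (∀ v → v ∈S S → ∃ λ s → v ≡ s ∷ʳ false) → append0 (unappend0 S) ≡ S
append0-unappend0 S ends-in-0 = ∈S-ext _ S from-S′ to-S′
  where
  from-S′ : ∀ v → v ∈S append0 (unappend0 S) → v ∈S S
  from-S′ v v∈ with s , refl , s∈ ← ∈-append0⁻ (unappend0 S) v v∈ =
    ∈-unappend0⁻ S s s∈
  to-S′ : ∀ v → v ∈S S → v ∈S append0 (unappend0 S)
  to-S′ v v∈ with s , refl ← ends-in-0 v v∈ =
    ∈-append0⁺ (unappend0 S) s (∈-unappend0⁺ S s v∈)

prepend0≢append0 : ∀ {n} {S T : Subset (suc n)} → Has1Head T → prepend0 S ≢ append0 T
prepend0≢append0 {T = node _ r} (x , x∈) e =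
  ∉∅ (x ∷ʳ false) (subst ((x ∷ʳ false) ∈S_) (sym (cong ones e)) (∈-append0⁺ r x x∈))

-- Cubes

ham-∷ʳ : ∀ {n} b (x y : Str n) → ham (x ∷ʳ b) (y ∷ʳ b) ≡ ham x y
ham-∷ʳ false []          []          = refl
ham-∷ʳ true  []          []          = refl
ham-∷ʳ b     (false ∷ x) (false ∷ y) = ham-∷ʳ b x y
ham-∷ʳ b     (true  ∷ x) (true  ∷ y) = ham-∷ʳ b x y
ham-∷ʳ b     (false ∷ x) (true  ∷ y) = cong suc (ham-∷ʳ b x y)
ham-∷ʳ b     (true  ∷ x) (false ∷ y) = cong suc (ham-∷ʳ b x y)

weight-∷ʳ0 : ∀ {n} (x : Str n) → weight (x ∷ʳ false) ≡ weight x
weight-∷ʳ0 []          = refl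
weight-∷ʳ0 (false ∷ x) = weight-∷ʳ0 x
weight-∷ʳ0 (true  ∷ x) = cong suc (weight-∷ʳ0 x)

Cube : ∀ {n} → (Str n → Set) → ℕ → ℕ → Subset n → Set
Cube V k d S = InducedQk V k S × BottomWeight S d

Cube-mono : ∀ {n k d} {V W : Str n → Set} {S} → (∀ v → v ∈S S → V v → W v) →
  Cube V k d S → Cube W k d S
Cube-mono V⇒W ((V-on-S , iso) , bottom) =
  ((λ v v∈ → V⇒W v v∈ (V-on-S v v∈)) , iso) , bottom

Cube-cong : ∀ {n k d} {V W : Str n → Set} {S} → (∀ v → V v ⇔ W v) →
  Cube V k d S ⇔ Cube W k d S
Cube-cong V⇔W = mk⇔ (Cube-mono λ v _ → to (V⇔W v)) (Cube-mono λ v _ → from (V⇔W v))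

module Transport {n n′} (g : Str n → Str n′)
  (g⁻¹ : Str n′ → Str n) (g⁻¹∘g : ∀ x → g⁻¹ (g x) ≡ x)
  (G : Subset n → Subset n′)
  (∈G⁺ : ∀ S s → s ∈S S → g s ∈S G S)
  (∈G⁻ : ∀ S v → v ∈S G S → ∃ λ s → v ≡ g s × s ∈S S)
  (ham-g : ∀ x y → ham (g x) (g y) ≡ ham x y)
  (weight-g : ∀ x → weight (g x) ≡ weight x) where

  InducedQk-image⁺ : ∀ {V k} S → InducedQk (V ∘ g) k S → InducedQk V k (G S)
  InducedQk-image⁺ {V} S (V-on-S , f , f-inj , f∈ , onto , f-adj , f-adj⁻) =
    V-on-GS , g ∘ f , gf-inj , (λ u → ∈G⁺ S (f u) (f∈ u)) , gf-onto ,
    (λ u u′ a → trans (ham-g _ _) (f-adj u u′ a)) ,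
    (λ u u′ a → f-adj⁻ u u′ (trans (sym (ham-g _ _)) a))
    where
    V-on-GS : ∀ v → v ∈S G S → V v
    V-on-GS v v∈ with s , refl , s∈ ← ∈G⁻ S v v∈ = V-on-S s s∈
    gf-inj : ∀ u u′ → g (f u) ≡ g (f u′) → u ≡ u′
    gf-inj u u′ e =
      f-inj u u′ (trans (sym (g⁻¹∘g (f u))) (trans (cong g⁻¹ e) (g⁻¹∘g (f u′))))
    gf-onto : ∀ v → v ∈S G S → ∃ λ u → g (f u) ≡ v
    gf-onto v v∈ with s , refl , s∈ ← ∈G⁻ S v v∈ with u , refl ← onto s s∈ = u , refl

  InducedQk-image⁻ : ∀ {V k} S → InducedQk V k (G S) → InducedQk (V ∘ g) k S
  InducedQk-image⁻ {V} S (V-on-GS , f , f-inj , f∈ , onto , f-adj , f-adj⁻) =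
    (λ s s∈ → V-on-GS (g s) (∈G⁺ S s s∈)) , g⁻¹ ∘ f , f′-inj , f′∈ , f′-onto ,
    (λ u u′ a → trans (ham-f′ u u′) (f-adj u u′ a)) ,
    (λ u u′ a → f-adj⁻ u u′ (trans (sym (ham-f′ u u′)) a))
    where
    g∘f′ : ∀ u → g (g⁻¹ (f u)) ≡ f u
    g∘f′ u with s , e , _ ← ∈G⁻ S (f u) (f∈ u) rewrite e = cong g (g⁻¹∘g s)
    f′-inj : ∀ u u′ → g⁻¹ (f u) ≡ g⁻¹ (f u′) → u ≡ u′
    f′-inj u u′ e = f-inj u u′ (trans (sym (g∘f′ u)) (trans (cong g e) (g∘f′ u′)))
    f′∈ : ∀ u → g⁻¹ (f u) ∈S S
    f′∈ u with s , e , s∈ ← ∈G⁻ S (f u) (f∈ u) rewrite e =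
      subst (_∈S S) (sym (g⁻¹∘g s)) s∈
    f′-onto : ∀ s → s ∈S S → ∃ λ u → g⁻¹ (f u) ≡ s
    f′-onto s s∈ with u , e ← onto (g s) (∈G⁺ S s s∈) =
      u , trans (cong g⁻¹ e) (g⁻¹∘g s)
    ham-f′ : ∀ u u′ → ham (g⁻¹ (f u)) (g⁻¹ (f u′)) ≡ ham (f u) (f u′)
    ham-f′ u u′ = trans (sym (ham-g _ _)) (cong₂ ham (g∘f′ u) (g∘f′ u′))

  BottomWeight-image⁺ : ∀ {d} S → BottomWeight S d → BottomWeight (G S) d
  BottomWeight-image⁺ {d} S ((s , s∈ , ws≡d) , d≤) =
    (g s , ∈G⁺ S s s∈ , trans (weight-g s) ws≡d) , d≤′
    where
    d≤′ : ∀ v → v ∈S G S → d ≤ weight v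
    d≤′ v v∈ with s′ , refl , s′∈ ← ∈G⁻ S v v∈ =
      subst (d ≤_) (sym (weight-g s′)) (d≤ s′ s′∈)

  BottomWeight-image⁻ : ∀ {d} S → BottomWeight (G S) d → BottomWeight S d
  BottomWeight-image⁻ {d} S ((v , v∈ , wv≡d) , d≤) with s , refl , s∈ ← ∈G⁻ S v v∈ =
    (s , s∈ , trans (sym (weight-g s)) wv≡d) ,
    (λ s′ s′∈ → subst (d ≤_) (weight-g s′) (d≤ (g s′) (∈G⁺ S s′ s′∈)))

  Cube-image : ∀ {V k d} S → Cube V k d (G S) ⇔ Cube (V ∘ g) k d S
  Cube-image S = mk⇔
    (λ (iso , bottom) → InducedQk-image⁻ S iso , BottomWeight-image⁻ S bottom)
    (λ (iso , bottom) → InducedQk-image⁺ S iso , BottomWeight-image⁺ S bottom)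

module Prepend0 {n} = Transport {n} (false ∷_) tail (λ _ → refl) prepend0
  (λ _ _ s∈ → s∈) ∈-prepend0⁻ (λ _ _ → refl) (λ _ → refl)
module Append0 {n} = Transport {n} (_∷ʳ false) init (init-∷ʳ false) append0
  ∈-append0⁺ ∈-append0⁻ (ham-∷ʳ false) weight-∷ʳ0

prepend0-Fib : ∀ {n k d} (S : Subset n) →
  Cube (FibRunV (suc n)) k d (prepend0 S) ⇔ Cube (FibRunV n) k d S
prepend0-Fib S = Cube-cong FibRunV-0∷ ⇔-∘ Prepend0.Cube-image S

prepend0-Luc : ∀ {n k d} (S : Subset n) →
  Cube (LucRunV (suc n)) k d (prepend0 S) ⇔ Cube (FibRunV n) k d S
prepend0-Luc S = Cube-cong LucRunV-0∷ ⇔-∘ Prepend0.Cube-image S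

append0-Luc⁺ : ∀ {n k d} (S : Subset n) →
  Cube (FibRunV n) k d S → Cube (LucRunV (suc n)) k d (append0 S)
append0-Luc⁺ S c = from (Append0.Cube-image S) (Cube-mono (λ v _ → LucRunV-∷ʳ0 v) c)

Luc-cube-with-1-head : ∀ {n k d} (S : Subset (suc (suc n))) →
  Cube (LucRunV (suc (suc n))) k d S → Has1Head S →
  S ≡ append0 (unappend0 S) × Cube (FibRunV (suc n)) k d (unappend0 S) × Has1Head (unappend0 S)
Luc-cube-with-1-head {n} {k} {d} S@(node l r) c@(iso@(S⊆Luc , _) , _) (x , x∈) =
  S≡ , Cube-mono Fib-on-S′ (to (Append0.Cube-image (unappend0 S)) (subst (Cube _ k d) S≡ c)) ,
  has1′
  where
  lift-head : ∀ b y → (b ∷ y) ∈S S → (true ∷ y) ∈S S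
  lift-head true  y y∈ = y∈
  lift-head false y y∈ = InducedQk-head-closed {x = x} {y} iso x∈ y∈
  tail-ends-in-0 : ∀ y → (true ∷ y) ∈S S → ∃ λ t → y ≡ t ∷ʳ false
  tail-ends-in-0 y y∈ with initLast y
  ... | t , false , refl = t , refl
  ... | t , true  , refl = ⊥-elim (¬LucRunV-1∷-∷ʳ1 t (S⊆Luc (true ∷ (t ∷ʳ true)) y∈))
  ends-in-0 : ∀ v → v ∈S S → ∃ λ s → v ≡ s ∷ʳ false
  ends-in-0 (b ∷ y) y∈ with t , refl ← tail-ends-in-0 y (lift-head b y y∈) = b ∷ t , refl
  S≡ : S ≡ append0 (unappend0 S)
  S≡ = sym (append0-unappend0 S ends-in-0)
  Fib-on-S′ : ∀ v → v ∈S unappend0 S → LucRunV _ (v ∷ʳ false) → FibRunV (suc n) v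
  Fib-on-S′ (true  ∷ t) _  h = LucRunV-1∷-∷ʳ0⁻ t h
  Fib-on-S′ (false ∷ t) t∈ _ =
    from (FibRunV-0∷ t) (FibRunV-1∷⁻ t (LucRunV-1∷-∷ʳ0⁻ t (S⊆Luc (true ∷ (t ∷ʳ false))
      (lift-head false (t ∷ʳ false) (∈-unappend0⁻ S (false ∷ t) t∈)))))
  has1′ : Has1Head (unappend0 S)
  has1′ with t , refl ← tail-ends-in-0 x x∈ = t , ∈-unappend0⁺ r t x∈

-- Counting

-- HasCount P m unfolds to Σ L (length L ≡ m × L Enumerates P).
_Enumerates_ : ∀ {A : Set} → List A → (A → Set) → Set
L Enumerates P = Unique L × (∀ x → (x ∈ L → P x) × (P x → x ∈ L))

Enumerates-length : ∀ {A : Set} {P : A → Set} {L L′ : List A} →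
  L Enumerates P → L′ Enumerates P → length L ≡ length L′
Enumerates-length {L = L} {L′} (L! , L≈P) (L′! , L′≈P) =
  ↭-length (∼bag⇒↭ (unique∧set⇒bag L! L′! L≈L′))
  where
  L≈L′ : ∀ {x} → x ∈ L ⇔ x ∈ L′
  L≈L′ {x} = mk⇔ (proj₂ (L′≈P x) ∘ proj₁ (L≈P x))
                 (proj₂ (L≈P x) ∘ proj₁ (L′≈P x))

Fib-enumeration : ∀ {n k d} {Lc : List (Subset n)} {Lb : List (Subset (suc n))} →
  Lc Enumerates Cube (FibRunV n) k d → Lb Enumerates Cube (FibRunV (suc n)) k d →
  (map prepend0 Lc ++ filter has1Head? Lb) Enumerates Cube (FibRunV (suc n)) k d
Fib-enumeration {n} {k} {d} {Lc} {Lb} (Lc! , Lc≈) (Lb! , Lb≈) =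
  unique , λ S → sound S , complete S
  where
  B₁ = filter has1Head? Lb
  B₁⁻ : ∀ {S} → S ∈ B₁ → S ∈ Lb × Has1Head S
  B₁⁻ = ∈-filter⁻ has1Head?
  disjoint : Disjoint (map prepend0 Lc) B₁
  disjoint (p , q) with S , _ , refl ← ∈-map⁻ prepend0 p =
    ¬Has1Head-prepend0 S (proj₂ (B₁⁻ q))
  unique : Unique (map prepend0 Lc ++ B₁)
  unique = ++⁺ (map⁺ prepend0-injective Lc!) (filter⁺ has1Head? Lb!) disjoint
  sound : ∀ S → S ∈ map prepend0 Lc ++ B₁ → Cube (FibRunV (suc n)) k d S
  sound S p with ∈-++⁻ (map prepend0 Lc) p
  ... | inj₁ q with S′ , S′∈ , refl ← ∈-map⁻ prepend0 q =
    from (prepend0-Fib S′) (proj₁ (Lc≈ S′) S′∈)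
  ... | inj₂ q = proj₁ (Lb≈ S) (proj₁ (B₁⁻ q))
  complete : ∀ S → Cube (FibRunV (suc n)) k d S → S ∈ map prepend0 Lc ++ B₁
  complete S@(node l r) c with has1Head? S
  ... | yes has1 = ∈-++⁺ʳ (map prepend0 Lc) (∈-filter⁺ has1Head? (proj₂ (Lb≈ S) c) has1)
  ... | no ¬has1 with refl ← uninhabited⇒≡∅ r ¬has1 =
    ∈-++⁺ˡ (∈-map⁺ prepend0 (proj₂ (Lc≈ l) (to (prepend0-Fib l) c)))

Luc-enumeration : ∀ {n k d} {Lb : List (Subset (suc n))} →
  Lb Enumerates Cube (FibRunV (suc n)) k d →
  (map prepend0 Lb ++ map append0 (filter has1Head? Lb)) Enumerates Cube (LucRunV (suc (suc n))) k d
Luc-enumeration {n} {k} {d} {Lb} (Lb! , Lb≈) = unique , λ S → sound S , complete S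
  where
  B₁ = filter has1Head? Lb
  B₁⁻ : ∀ {S} → S ∈ B₁ → S ∈ Lb × Has1Head S
  B₁⁻ = ∈-filter⁻ has1Head?
  disjoint : Disjoint (map prepend0 Lb) (map append0 B₁)
  disjoint (p , q) with _ , _ , refl ← ∈-map⁻ prepend0 p | T , T∈ , e ← ∈-map⁻ append0 q =
    prepend0≢append0 {T = T} (proj₂ (B₁⁻ T∈)) e
  unique : Unique (map prepend0 Lb ++ map append0 B₁)
  unique = ++⁺ (map⁺ prepend0-injective Lb!)
               (map⁺ append0-injective (filter⁺ has1Head? Lb!)) disjoint
  sound : ∀ S → S ∈ map prepend0 Lb ++ map append0 B₁ → Cube (LucRunV (suc (suc n))) k d S
  sound S p with ∈-++⁻ (map prepend0 Lb) p
  ... | inj₁ q with S′ , S′∈ , refl ← ∈-map⁻ prepend0 q =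
    from (prepend0-Luc S′) (proj₁ (Lb≈ S′) S′∈)
  ... | inj₂ q with S′ , S′∈ , refl ← ∈-map⁻ append0 q =
    append0-Luc⁺ S′ (proj₁ (Lb≈ S′) (proj₁ (B₁⁻ S′∈)))
  complete : ∀ S → Cube (LucRunV (suc (suc n))) k d S →
    S ∈ map prepend0 Lb ++ map append0 B₁
  complete S@(node l r) c with has1Head? S
  ... | no ¬has1 with refl ← uninhabited⇒≡∅ r ¬has1 =
    ∈-++⁺ˡ (∈-map⁺ prepend0 (proj₂ (Lb≈ l) (to (prepend0-Luc l) c)))
  ... | yes has1 = let S≡ , c′ , has1′ = Luc-cube-with-1-head S c has1 in
    subst (_∈ map prepend0 Lb ++ map append0 B₁) (sym S≡)
      (∈-++⁺ʳ (map prepend0 Lb)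
        (∈-map⁺ append0 (∈-filter⁺ has1Head? (proj₂ (Lb≈ (unappend0 S)) c′) has1′)))

two-step-recurrence : ∀ {a b c x : ℕ} → a ≡ b + x → b ≡ c + x → a + c ≡ 2 * b
two-step-recurrence {b = b} {c} {x} refl b≡c+x = begin
  b + x + c    ≡⟨ +-assoc b x c ⟩
  b + (x + c)  ≡⟨ cong (b +_) (trans (+-comm x c) (sym b≡c+x)) ⟩
  b + b        ≡⟨ cong (b +_) (sym (+-identityʳ b)) ⟩
  2 * b        ∎
  where open ≡-Reasoning

mainTheorem1 : (m k d a b c : ℕ) →
    CubeCoeff (suc (suc m)) (LucRunV (suc (suc m))) k d a →
    CubeCoeff (suc m) (FibRunV (suc m)) k d b →
    CubeCoeff m (FibRunV m) k d c →
    a + c ≡ 2 * b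
mainTheorem1 m k d _ _ _ (La , refl , La-enum) (Lb , refl , Lb-enum) (Lc , refl , Lc-enum) =
  two-step-recurrence a≡b+x b≡c+x
  where
  open ≡-Reasoning
  B₁ = filter has1Head? Lb
  a≡b+x : length La ≡ length Lb + length B₁
  a≡b+x = begin
    length La
      ≡⟨ Enumerates-length La-enum (Luc-enumeration Lb-enum) ⟩
    length (map prepend0 Lb ++ map append0 B₁)
      ≡⟨ length-++ (map prepend0 Lb) ⟩
    length (map prepend0 Lb) + length (map append0 B₁)
      ≡⟨ cong₂ _+_ (length-map prepend0 Lb) (length-map append0 B₁) ⟩
    length Lb + length B₁
      ∎
  b≡c+x : length Lb ≡ length Lc + length B₁
  b≡c+x = begin
    length Lb
      ≡⟨ Enumerates-length Lb-enum (Fib-enumeration Lc-enum Lb-enum) ⟩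
    length (map prepend0 Lc ++ B₁)
      ≡⟨ length-++ (map prepend0 Lc) ⟩
    length (map prepend0 Lc) + length B₁
      ≡⟨ cong (_+ length B₁) (length-map prepend0 Lc) ⟩
    length Lc + length B₁
      ∎
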